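{- Let $G$ be a simple graph of maximum degree at most $\Delta$ that is properly $(\Delta+C)$-edge colored except for one uncolored edge $(u,v)$, and let $T$ be a shift-tree of $G$ with respect to $(u,v)$. If $T$ has an active node $x$ (whose children have been constructed), with parent $p$, that has at most $C$ children, then the path in $T$ from $(u,v)$ to $(p,x)$ is a useful shiftable path: after shifting colors along it so that $(p,x)$ is the only uncolored edge, $(p,x)$ can be given a color not used by any adjacent edge.
   Context: For a vertex $w$, $A(w)$ is the set of colors not used on edges incident to $w$. Shifting colors along a chain $[e_1,\dots,e_k]$ (consecutive edges sharing one endpoint) gives each $e_i$ the current color of $e_{i+1}$ and leaves $e_k$ uncolored. Shift-tree $T$ w.r.t. $(u,v)$: root $v$; $u$ is regarded as the parent of $v$ but is not in $T$; leaves are active or inactive, the root active. Level $i+1$ from level $i$: inactive leaves remain leaves; for an active leaf $x$ with parent $p$, $y$ is a child of $x$ iff $(x,y)\in G$ and $\mathrm{color}(x,y)\in A'(p)$, where $A'(p)$ is the set of colors available at $p$ after shifting colors along the tree path from $(u,v)$ to $(p,x)$ so that $(p,x)$ becomes uncolored; a new child $y$ is active if it is the first occurrence of the vertex $y$ in $T$, otherwise inactive. Every such tree path is shiftable, i.e. each prefix shift yields a proper partial coloring. -}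

module Defs where

open import Data.Nat using (ℕ; zero; suc; _≤_; _<_)
open import Data.Fin using (Fin; zero) renaming (_<_ to _<ᶠ_)
open import Data.Fin.Properties using (_≟_)
open import Data.Bool using (Bool; true; false; _∧_; _∨_; if_then_else_)
open import Data.Maybe using (Maybe; just; nothing; maybe)
open import Data.List using (List; []; _∷_; _∷ʳ_; length; filterᵇ; take)
open import Data.List.Base using (allFin)
open import Data.Product using (Σ; _×_; ∃)
open import Data.Sum using (_⊎_)
open import Relation.Nullary using (¬_; does)
open import Relation.Binary.PropositionalEquality using (_≡_; _≢_)
open import Function.Bundles using (_⇔_)

record SimpleGraph (n : ℕ) : Set where
  field
    adj    : Fin n → Fin n → Bool
    sym    : ∀ a b → adj a b ≡ adj b a
    irrefl : ∀ a → adj a a ≡ false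
open SimpleGraph public

degree : ∀ {n} → SimpleGraph n → Fin n → ℕ
degree {n} G a = length (filterᵇ (adj G a) (allFin n))

MaxDegreeAtMost : ∀ {n} → SimpleGraph n → ℕ → Set
MaxDegreeAtMost G Δ = ∀ a → degree G a ≤ Δ

-- Partial edge colourings with k colours: col a b = colour of edge ab
-- (nothing = uncoloured / not an edge).

Colouring : ℕ → ℕ → Set
Colouring n k = Fin n → Fin n → Maybe (Fin k)

record Proper {n k} (G : SimpleGraph n) (c : Colouring n k) : Set where
  field
    symm    : ∀ a b → c a b ≡ c b a
    onEdges : ∀ a b α → c a b ≡ just α → adj G a b ≡ true
    proper  : ∀ a b b′ α → c a b ≡ just α → c a b′ ≡ just α → b ≡ b′

record ProperExcept {n k} (G : SimpleGraph n) (c : Colouring n k) (u v : Fin n) : Set where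
  field
    isProper     : Proper G c
    uvEdge       : adj G u v ≡ true
    uvUncoloured : c u v ≡ nothing
    onlyUV       : ∀ a b → adj G a b ≡ true → c a b ≡ nothing →
                   (a ≡ u × b ≡ v) ⊎ (a ≡ v × b ≡ u)

Avail : ∀ {n k} → Colouring n k → Fin n → Fin k → Set
Avail c w α = ∀ b → c w b ≢ just α

-- Shifting along the chain given by a vertex sequence w0 w1 … wk,
-- i.e. edges e_i = (w_{i-1}, w_i): e_i receives the (original) colour of
-- e_{i+1}, e_k becomes uncoloured, all other edges unchanged.

sameEdge : ∀ {n} → Fin n → Fin n → Fin n → Fin n → Bool
sameEdge a b x y = (does (a ≟ x) ∧ does (b ≟ y)) ∨ (does (a ≟ y) ∧ does (b ≟ x))

shift : ∀ {n k} → Colouring n k → List (Fin n) → Colouring n k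
shift c (a ∷ b ∷ []) x y = if sameEdge a b x y then nothing else c x y
shift c (a ∷ b ∷ d ∷ ws) x y =
  if sameEdge a b x y then c b d else shift c (b ∷ d ∷ ws) x y
shift c _ x y = c x y

-- Nodes are listed in construction (level) order: depth is monotone in
-- the index.  `height` is the number of levels whose children have been
-- constructed (nodes at depth `height` are the current leaves).

record LabelledTree (n : ℕ) : Set where
  field
    m        : ℕ
    lbl      : Fin (suc m) → Fin n
    parent   : Fin (suc m) → Maybe (Fin (suc m))
    depth    : Fin (suc m) → ℕ
    height   : ℕ
    rootNoParent : parent zero ≡ nothing
    nonRootParent : ∀ i → parent i ≡ nothing → i ≡ zero
    rootDepth  : depth zero ≡ 0
    parentDepth : ∀ i j → parent i ≡ just j → suc (depth j) ≡ depth i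
    depthMono  : ∀ i j → i <ᶠ j → depth i ≤ depth j
    depthBound : ∀ i → depth i ≤ height
open LabelledTree public

module _ {n : ℕ} (T : LabelledTree n) where

  Node : Set
  Node = Fin (suc (m T))

  -- labels from the root to node i (fuel = depth)
  ancestry : ℕ → Node → List (Fin n)
  ancestry zero i = lbl T i ∷ []
  ancestry (suc f) i = maybe (λ j → ancestry f j ∷ʳ lbl T i) (lbl T i ∷ []) (parent T i)

  -- the tree path as a vertex chain: u, v, …, p, x  (edges (u,v), …, (p,x))
  pathTo : Fin n → Node → List (Fin n)
  pathTo u i = u ∷ ancestry (depth T i) i

  parentLbl : Fin n → Node → Fin n
  parentLbl u i = maybe (lbl T) u (parent T i)

  Active : Node → Set
  Active i = ∀ j → j <ᶠ i → lbl T j ≢ lbl T i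

  isChildOfᵇ : Node → Node → Bool
  isChildOfᵇ i j with parent T j
  ... | nothing = false
  ... | just k  = does (k ≟ i)

  numChildren : Node → ℕ
  numChildren i = length (filterᵇ (isChildOfᵇ i) (allFin (suc (m T))))

module _ {n k : ℕ} (G : SimpleGraph n) (c : Colouring n k) (u v : Fin n)
         (T : LabelledTree n) where

  shiftedAt : Node T → Colouring n k
  shiftedAt i = shift c (pathTo T u i)

  ChildVertex : Node T → Fin n → Set
  ChildVertex i y = adj G (lbl T i) y ≡ true ×
    ∃ λ α → shiftedAt i (lbl T i) y ≡ just α × Avail (shiftedAt i) (parentLbl T u i) α

  record IsShiftTree : Set where
    field
      rootLabel  : lbl T zero ≡ v
      parentOK   : ∀ j i → parent T j ≡ just i → Active T i × depth T i < height T
      children   : ∀ i → Active T i → depth T i < height T → ∀ y →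
                   ChildVertex i y ⇔ (∃ λ j → parent T j ≡ just i × lbl T j ≡ y)
      childUnique : ∀ i j j′ → parent T j ≡ just i → parent T j′ ≡ just i →
                    lbl T j ≡ lbl T j′ → j ≡ j′
      shiftable  : ∀ i r → Proper G (shift c (take r (pathTo T u i)))

{-# OPTIONS --safe #-}
module Submission where

-- Shifting along the tree path to (p,x) leaves px uncoloured: x is active, so its label does not
-- occur earlier on the path and no earlier edge of the path is px, except possibly the root edge
-- read backwards, which cannot be the edge to a child of the root.  Hence at most deg p - 1 ≤ Δ - 1
-- colours are used at p.  A colour free at p but used on an edge xy makes y a child of x, so at
-- most C such colours exist.  Fewer than Δ + C colours are thus blocked, and one is free at both p
-- and x.

open import Defs
open import Data.Nat using (ℕ; zero; suc; _+_; _≤_; _<_; z<s)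
open import Data.Fin using (Fin; zero; suc) renaming (_<_ to _<ᶠ_)
open import Data.Product using (Σ; _×_; ∃; _,_; proj₁; proj₂)

open import Data.Bool using (true; false)
open import Data.Bool.Properties using (T-≡; ∧-zeroʳ)
open import Data.Empty using (⊥-elim)
open import Data.Fin.Properties
  using (_≟_; injective⇒≤; all?; any?; ¬∀⟶∃¬; <-cmp) renaming (<-trans to <ᶠ-trans)
open import Data.List using (List; []; _∷_; _∷ʳ_; _++_; map; length; filterᵇ; allFin; lookup)
open import Data.List.Membership.Propositional using (_∈_)
open import Data.List.Membership.Propositional.Properties
  using (∈-filter⁺; ∈-allFin; ∈-map⁺; ∈-++⁺ˡ; ∈-++⁺ʳ)
open import Data.List.Properties using (take-all; length-++; length-map)
open import Data.List.Relation.Unary.All using (All; []; _∷_)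
open import Data.List.Relation.Unary.All.Properties using (++⁺)
open import Data.List.Relation.Unary.Any using (index)
open import Data.List.Relation.Unary.Any.Properties using (lookup-index)
open import Data.Maybe using (just; nothing)
open import Data.Maybe.Properties using (just-injective) renaming (≡-dec to ≡-decᴹ)
open import Data.Nat.Properties using (≤-refl; ≤-trans; ≤-reflexive; +-mono-≤; suc-injective; 1+n≰n)
open import Data.Sum using (_⊎_; inj₁; inj₂)
open import Data.Unit using (⊤; tt)
open import Function.Bundles using (Equivalence)
open import Relation.Binary.Definitions using (tri<; tri≈; tri>)
open import Relation.Binary.PropositionalEquality
  using (_≡_; _≢_; refl; trans; cong; cong₂; subst; module ≡-Reasoning) renaming (sym to ≡-sym)
open import Relation.Nullary using (¬_; Dec; yes; no; does)
open import Relation.Nullary.Decidable using (dec-true; dec-false; ¬?; decidable-stable; _×-dec_; T?)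

module _ {A : Set} {k : ℕ} {xs : List A} (f : Fin k → A) where

  injection-into-list⇒≤length : (∀ i j → f i ≡ f j → i ≡ j) → (∀ i → f i ∈ xs) → k ≤ length xs
  injection-into-list⇒≤length f-inj f∈xs = injective⇒≤ index-inj
    where
    index-inj : ∀ {i j} → index (f∈xs i) ≡ index (f∈xs j) → i ≡ j
    index-inj {i} {j} eq = f-inj i j
      (trans (lookup-index (f∈xs i)) (trans (cong (lookup xs) eq) (≡-sym (lookup-index (f∈xs j)))))

module _ {n k : ℕ} (c : Colouring n k) where

  avail? : ∀ w α → Dec (Avail c w α)
  avail? w α = all? (λ b → ¬? (≡-decᴹ _≟_ (c w b) (just α)))

  ¬avail⇒used : ∀ {w α} → ¬ Avail c w α → ∃ λ b → c w b ≡ just α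
  ¬avail⇒used {w} {α} ¬avail with ¬∀⟶∃¬ n _ (λ b → ¬? (≡-decᴹ _≟_ (c w b) (just α))) ¬avail
  ... | b , ¬¬used = b , decidable-stable (≡-decᴹ _≟_ (c w b) (just α)) ¬¬used

neighbours : ∀ {n} → SimpleGraph n → Fin n → List (Fin n)
neighbours {n} G p = filterᵇ (adj G p) (allFin n)

∈-neighbours : ∀ {n} (G : SimpleGraph n) {p b} → adj G p b ≡ true → b ∈ neighbours G p
∈-neighbours G {p} {b} pb = ∈-filter⁺ (λ b → T? (adj G p b)) (∈-allFin b) (Equivalence.from T-≡ pb)

module _ {n k : ℕ} {G : SimpleGraph n} {c : Colouring n k} (c-proper : Proper G c)
         {p x : Fin n} (px-uncoloured : c p x ≡ nothing) (ys : List (Fin n)) where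

  -- The extra slot zero is taken by x, since the edge px uses no colour.
  Witness : Fin (suc k) → Fin n ⊎ Fin n → Set
  Witness zero    e        = e ≡ inj₁ x
  Witness (suc α) (inj₁ b) = c p b ≡ just α
  Witness (suc α) (inj₂ y) = y ∈ ys × c x y ≡ just α

  px-not-coloured : ∀ {α} → c p x ≢ just α
  px-not-coloured px-coloured with trans (≡-sym px-uncoloured) px-coloured
  ... | ()

  witness-determines-slot : ∀ s t e → Witness s e → Witness t e → s ≡ t
  witness-determines-slot zero    zero    _        _      _       = refl
  witness-determines-slot zero    (suc _) _        refl   px-col  = ⊥-elim (px-not-coloured px-col)
  witness-determines-slot (suc _) zero    _        px-col refl    = ⊥-elim (px-not-coloured px-col)
  witness-determines-slot (suc _) (suc _) (inj₁ _) pb-col pb-col′ =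
    cong suc (just-injective (trans (≡-sym pb-col) pb-col′))
  witness-determines-slot (suc _) (suc _) (inj₂ _) (_ , xy-col) (_ , xy-col′) =
    cong suc (just-injective (trans (≡-sym xy-col) xy-col′))

  witness∈ : adj G p x ≡ true → ∀ t e → Witness t e → e ∈ map inj₁ (neighbours G p) ++ map inj₂ ys
  witness∈ px-edge zero    _        refl       = ∈-++⁺ˡ (∈-map⁺ inj₁ (∈-neighbours G px-edge))
  witness∈ px-edge (suc α) (inj₁ b) pb-col     =
    ∈-++⁺ˡ (∈-map⁺ inj₁ (∈-neighbours G (Proper.onEdges c-proper p b α pb-col)))
  witness∈ px-edge (suc α) (inj₂ y) (y∈ys , _) = ∈-++⁺ʳ _ (∈-map⁺ inj₂ y∈ys)

  common-free-colour : adj G p x ≡ true →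
    (∀ y α → c x y ≡ just α → Avail c p α → y ∈ ys) →
    degree G p + length ys ≤ k →
    ∃ λ α → Avail c p α × Avail c x α
  common-free-colour px-edge ys-covers bound with any? (λ α → avail? c p α ×-dec avail? c x α)
  ... | yes common = common
  ... | no ¬common = ⊥-elim (1+n≰n (≤-trans slots≤witnesses (≤-trans (≤-reflexive witnesses-length) bound)))
    where
    witness : ∀ t → Σ (Fin n ⊎ Fin n) (Witness t)
    witness zero = inj₁ x , refl
    witness (suc α) with avail? c p α
    ... | no ¬free-p = let b , pb-col = ¬avail⇒used c ¬free-p in inj₁ b , pb-col
    ... | yes free-p with ¬avail⇒used c (λ free-x → ¬common (α , free-p , free-x))
    ... | y , xy-col = inj₂ y , ys-covers y α xy-col free-p , xy-col

    slots≤witnesses : suc k ≤ length (map inj₁ (neighbours G p) ++ map inj₂ ys)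
    slots≤witnesses = injection-into-list⇒≤length (λ t → proj₁ (witness t))
      (λ s t eq → witness-determines-slot s t (proj₁ (witness s)) (proj₂ (witness s))
                    (subst (Witness t) (≡-sym eq) (proj₂ (witness t))))
      (λ t → witness∈ px-edge t (proj₁ (witness t)) (proj₂ (witness t)))

    witnesses-length : length (map inj₁ (neighbours G p) ++ map inj₂ ys) ≡ degree G p + length ys
    witnesses-length = trans (length-++ (map inj₁ (neighbours G p)))
                             (cong₂ _+_ (length-map inj₁ (neighbours G p)) (length-map inj₂ ys))

module _ {n : ℕ} where

  sameEdge-refl : (a b : Fin n) → sameEdge a b a b ≡ true
  sameEdge-refl a b rewrite dec-true (a ≟ a) refl | dec-true (b ≟ b) refl = refl

  sameEdge-false : ∀ {s t a b : Fin n} → t ≢ b → ¬ (s ≡ b × t ≡ a) → sameEdge s t a b ≡ false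
  sameEdge-false {s} {t} {a} {b} t≢b ¬flipped
    rewrite dec-false (t ≟ b) t≢b | ∧-zeroʳ (does (s ≟ a)) with s ≟ b
  ... | no _    = refl
  ... | yes s≡b = dec-false (t ≟ a) (λ t≡a → ¬flipped (s≡b , t≡a))

  AvoidsEdge : Fin n → Fin n → List (Fin n) → Set
  AvoidsEdge a b (s ∷ t ∷ ws) = sameEdge s t a b ≡ false × AvoidsEdge a b (t ∷ ws)
  AvoidsEdge a b _            = ⊤

  All≢⇒avoidsEdge : ∀ {a b} ws → All (_≢ b) ws → AvoidsEdge a b ws
  All≢⇒avoidsEdge []           _                 = tt
  All≢⇒avoidsEdge (_ ∷ [])     _                 = tt
  All≢⇒avoidsEdge (_ ∷ t ∷ ws) (s≢b ∷ t≢b ∷ ≢b) =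
    sameEdge-false t≢b (λ flipped → s≢b (proj₁ flipped)) , All≢⇒avoidsEdge (t ∷ ws) (t≢b ∷ ≢b)

  module _ {k : ℕ} (c : Colouring n k) {a b : Fin n} where

    shift-skip : ∀ s t ws → sameEdge s t a b ≡ false → shift c (s ∷ t ∷ ws) a b ≡ shift c (t ∷ ws) a b
    shift-skip _ _ []      st≠ab rewrite st≠ab = refl
    shift-skip _ _ (_ ∷ _) st≠ab rewrite st≠ab = refl

    shift-uncolours-last : ∀ ws → AvoidsEdge a b (ws ∷ʳ a) → shift c (ws ∷ʳ a ∷ʳ b) a b ≡ nothing
    shift-uncolours-last []           _            rewrite sameEdge-refl a b = refl
    shift-uncolours-last (s ∷ [])     (sa≠ab , _)  =
      trans (shift-skip s a (b ∷ []) sa≠ab) (shift-uncolours-last [] tt)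
    shift-uncolours-last (s ∷ t ∷ ws) (st≠ab , av) =
      trans (shift-skip s t (ws ∷ʳ a ∷ʳ b) st≠ab) (shift-uncolours-last (t ∷ ws) av)

module _ {n : ℕ} (T : LabelledTree n) where

  parent-< : ∀ {i j} → parent T i ≡ just j → j <ᶠ i
  parent-< {i} {j} i↦j with <-cmp j i
  ... | tri< j<i _ _ = j<i
  ... | tri≈ _ refl _ = ⊥-elim (1+n≰n (≤-reflexive (parentDepth T i j i↦j)))
  ... | tri> _ _ i<j = ⊥-elim (1+n≰n (≤-trans (≤-reflexive (parentDepth T i j i↦j)) (depthMono T i j i<j)))

  depth≡0⇒root : ∀ {i} → depth T i ≡ 0 → i ≡ zero
  depth≡0⇒root {i} d≡0 with parent T i in i↦
  ... | nothing = nonRootParent T i i↦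
  ... | just j with trans (parentDepth T i j i↦) d≡0
  ... | ()

  ancestry-root : ∀ f → ancestry T f zero ≡ lbl T zero ∷ []
  ancestry-root zero = refl
  ancestry-root (suc f) rewrite rootNoParent T = refl

  ancestry-parent : ∀ f {i j} → parent T i ≡ just j → ancestry T (suc f) i ≡ ancestry T f j ∷ʳ lbl T i
  ancestry-parent f i↦j rewrite i↦j = refl

  ancestry-∷ʳ : ∀ f i → ∃ λ ws → ancestry T f i ≡ ws ∷ʳ lbl T i
  ancestry-∷ʳ zero    i = [] , refl
  ancestry-∷ʳ (suc f) i with parent T i
  ... | nothing = [] , refl
  ... | just j  = ancestry T f j , refl

  ancestry-from-root : ∀ f i → depth T i ≡ f → ∃ λ ws → ancestry T f i ≡ lbl T zero ∷ ws
  ancestry-from-root zero    i d≡0 rewrite depth≡0⇒root d≡0 = [] , refl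
  ancestry-from-root (suc f) i d≡f with parent T i in i↦
  ... | nothing rewrite nonRootParent T i i↦ = [] , refl
  ... | just j with ancestry-from-root f j (suc-injective (trans (parentDepth T i j i↦) d≡f))
  ...   | ws , from-root rewrite from-root = ws ∷ʳ lbl T i , refl

  ancestry-avoids-active : ∀ {x} → Active T x → ∀ f i → i <ᶠ x → All (_≢ lbl T x) (ancestry T f i)
  ancestry-avoids-active x-active zero    i i<x = x-active i i<x ∷ []
  ancestry-avoids-active x-active (suc f) i i<x with parent T i in i↦
  ... | nothing = x-active i i<x ∷ []
  ... | just j  = ++⁺ (ancestry-avoids-active x-active f j (<ᶠ-trans (parent-< i↦) i<x)) (x-active i i<x ∷ [])

  childList : Node T → List (Node T)
  childList x = filterᵇ (isChildOfᵇ T x) (allFin (suc (m T)))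

  ∈-childList : ∀ {x j} → parent T j ≡ just x → j ∈ childList x
  ∈-childList {x} {j} j↦x = ∈-filter⁺ (λ j → T? (isChildOfᵇ T x j)) (∈-allFin j) (Equivalence.from T-≡ isChild)
    where
    isChild : isChildOfᵇ T x j ≡ true
    isChild rewrite j↦x = dec-true (x ≟ x) refl

  module _ (u : Fin n) where

    pathTo-root : pathTo T u zero ≡ u ∷ lbl T zero ∷ []
    pathTo-root = cong (u ∷_) (ancestry-root (depth T zero))

    pathTo-∷ʳ : ∀ i → ∃ λ ws → pathTo T u i ≡ ws ∷ʳ lbl T i
    pathTo-∷ʳ i with ancestry-∷ʳ (depth T i) i
    ... | ws , ancestry≡ = u ∷ ws , cong (u ∷_) ancestry≡

    pathTo-parent : ∀ {i j} → parent T i ≡ just j → pathTo T u i ≡ pathTo T u j ∷ʳ lbl T i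
    pathTo-parent {i} {j} i↦j rewrite ≡-sym (parentDepth T i j i↦j) = cong (u ∷_) (ancestry-parent (depth T j) i↦j)

module ShiftTree {n k : ℕ} {G : SimpleGraph n} {c : Colouring n k} {u v : Fin n}
                 (c-except : ProperExcept G c u v) {T : LabelledTree n} (T-shift : IsShiftTree G c u v T) where
  open IsShiftTree T-shift

  c[_] : Node T → Colouring n k
  c[ i ] = shiftedAt G c u v T i

  shiftedAt-proper : ∀ i → Proper G c[ i ]
  shiftedAt-proper i =
    subst (λ ws → Proper G (shift c ws)) (take-all _ (pathTo T u i) ≤-refl) (shiftable i (length (pathTo T u i)))

  rootEdge-uncoloured : c[ zero ] u (lbl T zero) ≡ nothing
  rootEdge-uncoloured =
    subst (λ ws → shift c ws u (lbl T zero) ≡ nothing) (≡-sym (pathTo-root T u)) (shift-uncolours-last c [] tt)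

  parentEdge≢flippedRootEdge : ∀ {x j} → parent T x ≡ just j → ¬ (u ≡ lbl T x × lbl T zero ≡ lbl T j)
  -- A child of the root labelled u would hang off the edge vu, which the root shift uncolours.
  parentEdge≢flippedRootEdge {x} {zero} x↦root (u≡x , _) with parentOK x zero x↦root
  ... | root-active , root-expanded
      with Equivalence.from (children zero root-active root-expanded (lbl T x)) (x , x↦root , refl)
  ... | _ , α , root-x-coloured , _
      with trans (≡-sym rootEdge-uncoloured)
                 (subst (λ w → c[ zero ] w (lbl T zero) ≡ just α) (≡-sym u≡x)
                        (trans (Proper.symm (shiftedAt-proper zero) _ _) root-x-coloured))
  ... | ()
  parentEdge≢flippedRootEdge {x} {suc j} x↦j (_ , root≡j) = proj₁ (parentOK x (suc j) x↦j) zero z<s root≡j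

  pathTo-avoids-parentEdge : ∀ {x j} → Active T x → parent T x ≡ just j →
    AvoidsEdge (lbl T j) (lbl T x) (pathTo T u j)
  pathTo-avoids-parentEdge {x} {j} x-active x↦j
    with ancestry T (depth T j) j | ancestry-from-root T (depth T j) j refl
       | ancestry-avoids-active T x-active (depth T j) j (parent-< T x↦j)
  ... | ._ | ws , refl | root≢x ∷ ≢x =
    sameEdge-false root≢x (parentEdge≢flippedRootEdge x↦j) , All≢⇒avoidsEdge (lbl T zero ∷ ws) (root≢x ∷ ≢x)

  parentEdge-adjacent : ∀ x → adj G (parentLbl T u x) (lbl T x) ≡ true
  parentEdge-adjacent x with parent T x in x↦
  ... | nothing with nonRootParent T x x↦
  ...   | refl = subst (λ y → adj G u y ≡ true) (≡-sym rootLabel) (ProperExcept.uvEdge c-except)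
  parentEdge-adjacent x | just j with parentOK x j x↦
  ... | j-active , j-expanded = proj₁ (Equivalence.from (children j j-active j-expanded (lbl T x)) (x , x↦ , refl))

  parentEdge-uncoloured : ∀ {x} → Active T x → c[ x ] (parentLbl T u x) (lbl T x) ≡ nothing
  parentEdge-uncoloured {x} x-active with parent T x in x↦
  ... | nothing with nonRootParent T x x↦
  ...   | refl = rootEdge-uncoloured
  parentEdge-uncoloured {x} x-active | just j with pathTo-∷ʳ T u j
  ... | ws , path≡ = begin
    shift c (pathTo T u x) (lbl T j) (lbl T x)
      ≡⟨ cong (λ ws′ → shift c ws′ (lbl T j) (lbl T x)) (trans (pathTo-parent T u x↦) (cong (_∷ʳ lbl T x) path≡)) ⟩
    shift c (ws ∷ʳ lbl T j ∷ʳ lbl T x) (lbl T j) (lbl T x)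
      ≡⟨ shift-uncolours-last c ws (subst (AvoidsEdge _ _) path≡ (pathTo-avoids-parentEdge x-active x↦)) ⟩
    nothing ∎
    where open ≡-Reasoning

  children-cover : ∀ {x} → Active T x → depth T x < height T →
    ∀ y α → c[ x ] (lbl T x) y ≡ just α → Avail c[ x ] (parentLbl T u x) α → y ∈ map (lbl T) (childList T x)
  children-cover {x} x-active x-expanded y α xy-coloured free-at-parent
    with Equivalence.to (children x x-active x-expanded y)
           (Proper.onEdges (shiftedAt-proper x) _ _ α xy-coloured , α , xy-coloured , free-at-parent)
  ... | j , j↦x , refl = ∈-map⁺ (lbl T) (∈-childList T j↦x)

mainTheorem12 : ∀ {n} (Δ C : ℕ) (G : SimpleGraph n) → MaxDegreeAtMost G Δ →
    (c : Colouring n (Δ + C)) (u v : Fin n) → ProperExcept G c u v →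
    (T : LabelledTree n) → IsShiftTree G c u v T →
    (x : Node T) → Active T x → depth T x < height T → numChildren T x ≤ C →
    Proper G (shiftedAt G c u v T x) ×
    ∃ λ α → Avail (shiftedAt G c u v T x) (parentLbl T u x) α ×
            Avail (shiftedAt G c u v T x) (lbl T x) α
mainTheorem12 Δ C G Δ-bound c u v c-except T T-shift x x-active x-expanded few-children =
  shiftedAt-proper x ,
  common-free-colour (shiftedAt-proper x) (parentEdge-uncoloured x-active) (map (lbl T) (childList T x))
    (parentEdge-adjacent x) (children-cover x-active x-expanded) degree-bound
  where
  open ShiftTree c-except T-shift

  degree-bound : degree G (parentLbl T u x) + length (map (lbl T) (childList T x)) ≤ Δ + C
  degree-bound = +-mono-≤ (Δ-bound _) (≤-trans (≤-reflexive (length-map (lbl T) (childList T x))) few-children)
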